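{- Fix an integer $j \geq 1$ and let $\mathfrak{p} = (x\bar{x})^j x$. Let $\mu \in F^{[\mathfrak{p}]}$ be a primitive path. Then the complement $\mu^c$ contains the pattern $\mathfrak{p} = (x\bar{x})^j x$ if and only if $\mu$ contains the pattern $\mathfrak{p}' = \bar{x}\bar{x}(x\bar{x})^j\bar{x}$.
   Context: Binary words over $\{0,1\}$ are identified with lattice paths: each letter 1 is a rise step $x=(1,1)$ and each letter 0 is a fall step $\bar{x}=(1,-1)$; paths start at ordinate $0$, so a path is a word over $\{x,\bar{x}\}$. For a word $w$, $w^h$ denotes $w$ concatenated $h$ times. $F$ is the set of binary words $\omega$ with $|\omega|_0 \leq |\omega|_1$ (no more 0's than 1's). A word contains a pattern $\mathfrak{q}$ if $\mathfrak{q}$ occurs as a factor (a block of consecutive letters); $F^{[\mathfrak{p}]}$ is the set of words in $F$ that do not contain $\mathfrak{p}$. A path is primitive if it begins and ends at ordinate $0$ and stays strictly above the $x$-axis at all intermediate points. The complement $\varphi^c$ of a path $\varphi$ is obtained by exchanging every rise step with a fall step and vice versa. -}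

module Defs where

open import Data.Nat using (ℕ; zero; suc; _≤_; _<_; _+_)
open import Data.Integer using (ℤ; +_; -[1+_]; _-_) renaming (_+_ to _+ℤ_; _<_ to _<ℤ_)
open import Data.List using (List; []; _∷_; _++_; length; take; concat; replicate)
open import Data.Product using (Σ; ∃; _×_; _,_)
open import Relation.Binary.PropositionalEquality using (_≡_)
open import Relation.Nullary using (¬_)

-- Steps of a lattice path: x = rise (letter 1), x̄ = fall (letter 0).
data Step : Set where
  x  : Step
  x̄ : Step

Path : Set
Path = List Step

_^_ : Path → ℕ → Path
w ^ zero  = []
w ^ suc h = w ++ (w ^ h)

#x : Path → ℕ
#x []        = 0
#x (x  ∷ w)  = suc (#x w)
#x (x̄ ∷ w)  = #x w

#x̄ : Path → ℕ
#x̄ []        = 0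
#x̄ (x  ∷ w)  = #x̄ w
#x̄ (x̄ ∷ w)  = suc (#x̄ w)

InF : Path → Set
InF w = #x̄ w ≤ #x w

Contains : Path → Path → Set
Contains w q = Σ Path λ u → Σ Path λ v → w ≡ u ++ q ++ v

InF-avoiding : Path → Path → Set
InF-avoiding p w = InF w × ¬ Contains w p

height : Path → ℤ
height w = + #x w - + #x̄ w

Primitive : Path → Set
Primitive w = (0 < length w) × (height w ≡ + 0)
  × ((k : ℕ) → 0 < k → k < length w → + 0 <ℤ height (take k w))

comp : Step → Step
comp x  = x̄
comp x̄ = x

_ᶜ : Path → Path
[] ᶜ      = []
(s ∷ w) ᶜ = comp s ∷ (w ᶜ)

𝔭 : ℕ → Path
𝔭 j = ((x ∷ x̄ ∷ []) ^ j) ++ (x ∷ [])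

𝔭′ : ℕ → Path
𝔭′ j = x̄ ∷ x̄ ∷ (((x ∷ x̄ ∷ []) ^ j) ++ (x̄ ∷ []))

-- μᶜ contains 𝔭 iff μ contains 𝔭ᶜ = (x̄x)ʲx̄, and 𝔭ᶜ is a factor of 𝔭′ = x̄𝔭ᶜx̄,
-- so only one direction needs an argument. Look at the letters around an
-- occurrence of 𝔭ᶜ in μ: a rise after it or before it would create 𝔭
-- (x̄𝔭 = 𝔭ᶜx and x𝔭ᶜ = 𝔭x̄); the occurrence cannot start μ, which begins with a
-- rise, nor end μ, since μ would then be back on the axis one step after the
-- occurrence began (this needs j ≥ 1). Hence it is flanked by two falls.
module Submission where

open import Defs
open import Data.Nat using (ℕ; zero; suc; _+_; _≤_; _<_; s≤s; z≤n)
open import Data.Nat.Properties using (m<m+n)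
open import Data.Integer using (+_; _-_) renaming (_+_ to _+ℤ_; _<_ to _<ℤ_)
import Data.Integer.Properties as ℤ
open import Data.Integer.Tactic.RingSolver using (solve-∀)
open import Data.List using ([]; _∷_; _++_; length; take; initLast; _∷ʳ′_)
open import Data.List.Properties using (++-assoc; ++-identityʳ; length-++; length-++-sucʳ)
open import Data.Product using (_×_; _,_)
open import Data.Empty using (⊥-elim)
open import Function using (_∘_; flip)
open import Relation.Binary.PropositionalEquality
open import Relation.Nullary using (¬_)

^-rotate : ∀ (u v : Path) n → (u ++ v) ^ n ++ u ≡ u ++ (v ++ u) ^ n
^-rotate u v zero    = sym (++-identityʳ u)
^-rotate u v (suc n) = begin
  ((u ++ v) ++ (u ++ v) ^ n) ++ u  ≡⟨ ++-assoc (u ++ v) _ u ⟩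
  (u ++ v) ++ (u ++ v) ^ n ++ u    ≡⟨ cong ((u ++ v) ++_) (^-rotate u v n) ⟩
  (u ++ v) ++ u ++ (v ++ u) ^ n    ≡⟨ ++-assoc u v _ ⟩
  u ++ v ++ u ++ (v ++ u) ^ n      ≡⟨ cong (u ++_) (sym (++-assoc v u _)) ⟩
  u ++ (v ++ u) ++ (v ++ u) ^ n    ∎
  where open ≡-Reasoning

ᶜ-involutive : ∀ w → (w ᶜ) ᶜ ≡ w
ᶜ-involutive []       = refl
ᶜ-involutive (x ∷ w)  = cong (x ∷_) (ᶜ-involutive w)
ᶜ-involutive (x̄ ∷ w) = cong (x̄ ∷_) (ᶜ-involutive w)

ᶜ-++ : ∀ u v → (u ++ v) ᶜ ≡ u ᶜ ++ v ᶜ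
ᶜ-++ []      v = refl
ᶜ-++ (s ∷ u) v = cong (comp s ∷_) (ᶜ-++ u v)

ᶜ-^ : ∀ w n → (w ^ n) ᶜ ≡ (w ᶜ) ^ n
ᶜ-^ w zero    = refl
ᶜ-^ w (suc n) = trans (ᶜ-++ w (w ^ n)) (cong (w ᶜ ++_) (ᶜ-^ w n))

Contains-trans : ∀ {w q p} → Contains w q → Contains q p → Contains w p
Contains-trans {w} {q} {p} (u , v , w≡) (u′ , v′ , q≡) = u ++ u′ , v′ ++ v , (begin
  w                            ≡⟨ w≡ ⟩
  u ++ q ++ v                  ≡⟨ cong (λ r → u ++ r ++ v) q≡ ⟩
  u ++ (u′ ++ p ++ v′) ++ v    ≡⟨ cong (u ++_) (++-assoc u′ _ v) ⟩
  u ++ u′ ++ (p ++ v′) ++ v    ≡⟨ cong (λ r → u ++ u′ ++ r) (++-assoc p v′ v) ⟩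
  u ++ u′ ++ p ++ v′ ++ v      ≡⟨ sym (++-assoc u u′ _) ⟩
  (u ++ u′) ++ p ++ v′ ++ v    ∎)
  where open ≡-Reasoning

Contains-ᶜ : ∀ {w p} → Contains w p → Contains (w ᶜ) (p ᶜ)
Contains-ᶜ {w} {p} (u , v , w≡) =
  u ᶜ , v ᶜ , trans (cong _ᶜ w≡) (trans (ᶜ-++ u (p ++ v)) (cong (u ᶜ ++_) (ᶜ-++ p v)))

#x-++ : ∀ u v → #x (u ++ v) ≡ #x u + #x v
#x-++ []       v = refl
#x-++ (x ∷ u)  v = cong suc (#x-++ u v)
#x-++ (x̄ ∷ u) v = #x-++ u v

#x̄-++ : ∀ u v → #x̄ (u ++ v) ≡ #x̄ u + #x̄ v
#x̄-++ []       v = refl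
#x̄-++ (x ∷ u)  v = #x̄-++ u v
#x̄-++ (x̄ ∷ u) v = cong suc (#x̄-++ u v)

height-++ : ∀ u v → height (u ++ v) ≡ height u +ℤ height v
height-++ u v = begin
  + #x (u ++ v) - + #x̄ (u ++ v)             ≡⟨ cong₂ (λ a b → + a - + b) (#x-++ u v) (#x̄-++ u v) ⟩
  + (#x u + #x v) - + (#x̄ u + #x̄ v)         ≡⟨ cong₂ _-_ (ℤ.pos-+ (#x u) _) (ℤ.pos-+ (#x̄ u) _) ⟩
  (+ #x u +ℤ + #x v) - (+ #x̄ u +ℤ + #x̄ v)  ≡⟨ interchange (+ #x u) (+ #x̄ u) (+ #x v) (+ #x̄ v) ⟩
  height u +ℤ height v                       ∎
  where
  open ≡-Reasoning

  interchange : ∀ a b c d → (a +ℤ c) - (b +ℤ d) ≡ (a - b) +ℤ (c - d)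
  interchange = solve-∀

height-^ : ∀ w n → height w ≡ + 0 → height (w ^ n) ≡ + 0
height-^ w zero    _  = refl
height-^ w (suc n) h₀ =
  trans (height-++ w (w ^ n)) (cong₂ _+ℤ_ h₀ (height-^ w n h₀))

take-length-++ : ∀ (u v : Path) → take (length u) (u ++ v) ≡ u
take-length-++ []      v = refl
take-length-++ (s ∷ u) v = cong (s ∷_) (take-length-++ u v)

¬Primitive-x̄∷ : ∀ w → ¬ Primitive (x̄ ∷ w)
¬Primitive-x̄∷ []      (_ , () , _)
¬Primitive-x̄∷ (_ ∷ _) (_ , _ , above) with above 1 (s≤s z≤n) (s≤s (s≤s z≤n))
... | ()

¬Primitive-return : ∀ u s v → 0 < length u → height u ≡ + 0 → ¬ Primitive (u ++ s ∷ v)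
¬Primitive-return u s v 0<u h₀ (_ , _ , above) = ℤ.<-irrefl (sym h₀) (subst (+ 0 <ℤ_)
  (cong height (take-length-++ u (s ∷ v)))
  (above (length u) 0<u (subst (length u <_) (sym (length-++ u)) (m<m+n (length u) (s≤s z≤n)))))

alt : ℕ → Path
alt j = (x ∷ x̄ ∷ []) ^ j

𝔭≡x∷ : ∀ j → 𝔭 j ≡ x ∷ (x̄ ∷ x ∷ []) ^ j
𝔭≡x∷ = ^-rotate (x ∷ []) (x̄ ∷ [])

𝔭ᶜ≡ : ∀ j → 𝔭 j ᶜ ≡ (x̄ ∷ x ∷ []) ^ j ++ x̄ ∷ []
𝔭ᶜ≡ j = trans (ᶜ-++ (alt j) (x ∷ [])) (cong (_++ x̄ ∷ []) (ᶜ-^ (x ∷ x̄ ∷ []) j))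

𝔭ᶜ≡x̄∷ : ∀ j → 𝔭 j ᶜ ≡ x̄ ∷ alt j
𝔭ᶜ≡x̄∷ j = trans (𝔭ᶜ≡ j) (^-rotate (x̄ ∷ []) (x ∷ []) j)

𝔭-in-𝔭ᶜ∷ʳx : ∀ j → Contains (𝔭 j ᶜ ++ x ∷ []) (𝔭 j)
𝔭-in-𝔭ᶜ∷ʳx j = x̄ ∷ [] , [] ,
  trans (cong (_++ x ∷ []) (𝔭ᶜ≡x̄∷ j)) (cong (x̄ ∷_) (sym (++-identityʳ (𝔭 j))))

𝔭-in-x∷𝔭ᶜ : ∀ j → Contains (x ∷ 𝔭 j ᶜ) (𝔭 j)
𝔭-in-x∷𝔭ᶜ j = [] , x̄ ∷ [] ,
  trans (cong (x ∷_) (𝔭ᶜ≡ j)) (cong (_++ x̄ ∷ []) (sym (𝔭≡x∷ j)))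

𝔭′≡ : ∀ j → 𝔭′ j ≡ x̄ ∷ 𝔭 j ᶜ ++ x̄ ∷ []
𝔭′≡ j = cong (λ w → x̄ ∷ w ++ x̄ ∷ []) (sym (𝔭ᶜ≡x̄∷ j))

𝔭ᶜ-in-𝔭′ : ∀ j → Contains (𝔭′ j) (𝔭 j ᶜ)
𝔭ᶜ-in-𝔭′ j = x̄ ∷ [] , x̄ ∷ [] , 𝔭′≡ j

¬Primitive-++𝔭ᶜ : ∀ j U → ¬ Primitive (U ++ 𝔭 (suc j) ᶜ)
¬Primitive-++𝔭ᶜ j U prim@(_ , h₀ , _) =
  ¬Primitive-return (U ++ x̄ ∷ []) x (x̄ ∷ alt j) 0<U∷ʳx̄ hU∷ʳx̄ (subst Primitive split prim)
  where
  open ≡-Reasoning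
  split : U ++ 𝔭 (suc j) ᶜ ≡ (U ++ x̄ ∷ []) ++ alt (suc j)
  split = trans (cong (U ++_) (𝔭ᶜ≡x̄∷ (suc j))) (sym (++-assoc U (x̄ ∷ []) _))

  0<U∷ʳx̄ : 0 < length (U ++ x̄ ∷ [])
  0<U∷ʳx̄ = subst (0 <_) (sym (length-++-sucʳ U x̄ [])) (s≤s z≤n)

  hU∷ʳx̄ : height (U ++ x̄ ∷ []) ≡ + 0
  hU∷ʳx̄ = begin
    height (U ++ x̄ ∷ [])                          ≡⟨ sym (ℤ.+-identityʳ _) ⟩
    height (U ++ x̄ ∷ []) +ℤ + 0                   ≡⟨ cong (height (U ++ x̄ ∷ []) +ℤ_) (sym (height-^ (x ∷ x̄ ∷ []) (suc j) refl)) ⟩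
    height (U ++ x̄ ∷ []) +ℤ height (alt (suc j))  ≡⟨ sym (height-++ (U ++ x̄ ∷ []) _) ⟩
    height ((U ++ x̄ ∷ []) ++ alt (suc j))         ≡⟨ cong height (sym split) ⟩
    height (U ++ 𝔭 (suc j) ᶜ)                     ≡⟨ h₀ ⟩
    + 0                                           ∎

𝔭ᶜ⇒𝔭′ : ∀ j → 1 ≤ j → (μ : Path) → ¬ Contains μ (𝔭 j) → Primitive μ →
        Contains μ (𝔭 j ᶜ) → Contains μ (𝔭′ j)
𝔭ᶜ⇒𝔭′ j _ μ avoid prim (U , x ∷ V , μ≡) = ⊥-elim (avoid (Contains-trans
  (U , V , trans μ≡ (cong (U ++_) (sym (++-assoc (𝔭 j ᶜ) (x ∷ []) V))))
  (𝔭-in-𝔭ᶜ∷ʳx j)))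
𝔭ᶜ⇒𝔭′ .(suc j) (s≤s {n = j} z≤n) μ _ prim (U , [] , μ≡) =
  ⊥-elim (¬Primitive-++𝔭ᶜ j U (subst Primitive (trans μ≡ (cong (U ++_) (++-identityʳ _))) prim))
𝔭ᶜ⇒𝔭′ j _ μ avoid prim (U , x̄ ∷ V , μ≡) with initLast U
... | [] = ⊥-elim (¬Primitive-x̄∷ (alt j ++ x̄ ∷ V) (subst Primitive (trans μ≡ μ-head) prim))
  where
  μ-head : 𝔭 j ᶜ ++ x̄ ∷ V ≡ x̄ ∷ alt j ++ x̄ ∷ V
  μ-head = cong (_++ x̄ ∷ V) (𝔭ᶜ≡x̄∷ j)
... | U′ ∷ʳ′ x = ⊥-elim (avoid (Contains-trans
  (U′ , x̄ ∷ V , trans μ≡ (++-assoc U′ (x ∷ []) _)) (𝔭-in-x∷𝔭ᶜ j)))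
... | U′ ∷ʳ′ x̄ = U′ , V , (begin
  μ                                     ≡⟨ μ≡ ⟩
  (U′ ++ x̄ ∷ []) ++ 𝔭 j ᶜ ++ x̄ ∷ V    ≡⟨ ++-assoc U′ (x̄ ∷ []) _ ⟩
  U′ ++ x̄ ∷ 𝔭 j ᶜ ++ x̄ ∷ V            ≡⟨ cong (λ r → U′ ++ x̄ ∷ r) (sym (++-assoc (𝔭 j ᶜ) (x̄ ∷ []) V)) ⟩
  U′ ++ (x̄ ∷ 𝔭 j ᶜ ++ x̄ ∷ []) ++ V   ≡⟨ cong (λ r → U′ ++ r ++ V) (sym (𝔭′≡ j)) ⟩
  U′ ++ 𝔭′ j ++ V                       ∎)
  where open ≡-Reasoning

proposition1 : (j : ℕ) → 1 ≤ j → (μ : Path) → InF-avoiding (𝔭 j) μ → Primitive μ →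
    (Contains (μ ᶜ) (𝔭 j) → Contains μ (𝔭′ j)) × (Contains μ (𝔭′ j) → Contains (μ ᶜ) (𝔭 j))
proposition1 j 1≤j μ (_ , avoid) prim = to , from
  where
  to : Contains (μ ᶜ) (𝔭 j) → Contains μ (𝔭′ j)
  to = 𝔭ᶜ⇒𝔭′ j 1≤j μ avoid prim ∘ subst (λ w → Contains w (𝔭 j ᶜ)) (ᶜ-involutive μ) ∘ Contains-ᶜ

  from : Contains μ (𝔭′ j) → Contains (μ ᶜ) (𝔭 j)
  from = subst (Contains (μ ᶜ)) (ᶜ-involutive (𝔭 j)) ∘ Contains-ᶜ ∘ flip Contains-trans (𝔭ᶜ-in-𝔭′ j)
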